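{- Let $G$ be a chordal graph. If $G$ is $P_7$-free, then $\mathcal{D}_{RN}(G)$ is an independence system; if $G$ is $P_8$-free, then $\mathcal{D}_{RN}(G)$ is an accessible set system.
   Context: All graphs are finite, simple and undirected; $N[x]$ is the closed neighbourhood of $x$ and $N[X]=\bigcup_{x\in X}N[x]$; a minimal dominating set is an inclusion-minimal $D$ with $N[D]=V(G)$. A vertex $x$ is irredundant if $N[x]$ is inclusion-minimal in $\{N[y]:y\in V(G)\}$, with the convention that among several vertices having the same inclusion-minimal closed neighbourhood exactly one (fixed) is declared irredundant; all other vertices are redundant; $RN(G)$ is the set of redundant vertices. $\mathcal{D}_{RN}(G)=\{D\cap RN(G): D\text{ a minimal dominating set of }G\}$. A family $\mathcal{F}$ of sets is an independence system if for every non-empty $X\in\mathcal{F}$ and every $x\in X$, $X\setminus\{x\}\in\mathcal{F}$; it is an accessible set system if every non-empty $X\in\mathcal{F}$ contains some $x$ with $X\setminus\{x\}\in\mathcal{F}$. $P_k$-free means no induced path on $k$ vertices; chordal means no induced cycle of length at least four. -}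

module Defs where

open import Data.Nat using (ℕ; zero; suc; _≥_)
open import Data.Fin using (Fin; toℕ; _≟_)
open import Data.Fin.Subset using (Subset; _∈_; _⊆_; _⊂_; _∩_; _-_; Nonempty)
open import Data.Bool using (Bool; true; false; _∨_)
open import Data.Vec using (tabulate)
open import Data.Product using (Σ; ∃; _×_; _,_)
open import Data.Sum using (_⊎_)
open import Relation.Nullary using (¬_; does)
open import Relation.Binary.PropositionalEquality using (_≡_)
open import Function.Definitions using (Injective)
open import Function.Bundles using (_⇔_)

record Graph (n : ℕ) : Set where
  field
    adj     : Fin n → Fin n → Bool
    sym     : ∀ x y → adj x y ≡ adj y x
    irrefl  : ∀ x → adj x x ≡ false
open Graph public

module _ {n : ℕ} (G : Graph n) where

  N[_] : Fin n → Subset n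
  N[ x ] = tabulate (λ y → does (x ≟ y) ∨ adj G x y)

  Dominating : Subset n → Set
  Dominating D = ∀ v → ∃ λ d → d ∈ D × v ∈ N[ d ]

  MinimalDominating : Subset n → Set
  MinimalDominating D = Dominating D × (∀ D' → D' ⊂ D → ¬ Dominating D')

  -- x is irredundant: N[x] is inclusion-minimal among closed neighbourhoods,
  -- and x is the (fixed) representative, chosen as the least index, among the
  -- vertices with the same closed neighbourhood.
  Irredundant : Fin n → Set
  Irredundant x = (∀ y → ¬ (N[ y ] ⊂ N[ x ]))
                × (∀ y → toℕ y Data.Nat.< toℕ x → ¬ (N[ y ] ≡ N[ x ]))

  Redundant : Fin n → Set
  Redundant x = ¬ Irredundant x

  -- X ∈ 𝒟_RN(G)  iff  X = D ∩ RN(G) for some minimal dominating set D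
  -- (stated pointwise, since RN(G) is given as a predicate)
  InDRN : Subset n → Set
  InDRN X = ∃ λ D → MinimalDominating D
                  × (∀ v → (v ∈ X) ⇔ (v ∈ D × Redundant v))

  PathAdj : ∀ {k} → Fin k → Fin k → Set
  PathAdj i j = suc (toℕ i) ≡ toℕ j ⊎ suc (toℕ j) ≡ toℕ i

  HasInducedPath : ℕ → Set
  HasInducedPath k = Σ (Fin k → Fin n) λ f → Injective _≡_ _≡_ f
                      × (∀ i j → (adj G (f i) (f j) ≡ true) ⇔ PathAdj i j)

  PFree : ℕ → Set
  PFree k = ¬ HasInducedPath k

  CycAdj : ∀ {m} → Fin m → Fin m → Set
  CycAdj {m} i j = PathAdj i j
                 ⊎ (toℕ i ≡ 0 × suc (toℕ j) ≡ m)
                 ⊎ (toℕ j ≡ 0 × suc (toℕ i) ≡ m)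

  HasInducedCycle : ℕ → Set
  HasInducedCycle m = Σ (Fin m → Fin n) λ f → Injective _≡_ _≡_ f
                      × (∀ i j → (adj G (f i) (f j) ≡ true) ⇔ CycAdj i j)

  Chordal : Set
  Chordal = ∀ m → m ≥ 4 → ¬ HasInducedCycle m

IndependenceSystem : ∀ {n} → (Subset n → Set) → Set
IndependenceSystem F = ∀ X → F X → Nonempty X → ∀ x → x ∈ X → F (X - x)

AccessibleSetSystem : ∀ {n} → (Subset n → Set) → Set
AccessibleSetSystem F = ∀ X → F X → Nonempty X → ∃ λ x → x ∈ X × F (X - x)

module Submission where

-- Let D be a minimal dominating set, X = D ∩ RN(G) and x ∈ X.  Replace x by its
-- irredundant private neighbours and shrink the resulting dominating set D₁ to a
-- minimal dominating set D' (exchange lemma).  The added vertices are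
-- irredundant, so D' ∩ RN(G) ⊆ X - x; conversely every z ∈ X - x keeps a private
-- neighbour with respect to D₁, hence lies in D', unless an irredundant private
-- neighbour w of x is near a private neighbour u of z, where z has a second
-- dominator d ∈ D with private neighbour q.  Then x–w–u–z–d–q is an induced path.
-- As u ∈ N[w] - N[x] and w is irredundant, some r ∈ N[x] - N[w] prolongs it to an
-- induced P₇; if x has a second dominator e with private neighbour s, then
-- s–e–x–w–u–z–d–q is an induced P₈.  Accessibility removes such a doubly
-- dominated x if one exists; otherwise the exchange condition is vacuous.
-- All induced paths are built by one chordal extension lemma: a vertex adjacent
-- to the first vertex of an induced path and far from the second is far from all
-- others, since otherwise it closes an induced cycle of length at least four.

open import Defs hiding (sym)
open import Data.Nat as ℕ using (ℕ; suc; s≤s; z≤n)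
open import Data.Nat.Properties using (suc-injective)
open import Data.Fin using (Fin; zero; suc; toℕ; _≟_; _<_)
open import Data.Fin.Properties using (any?; all?; ¬∀⟶∃¬; _<?_)
open import Data.Fin.Induction using (<-wellFounded)
open import Data.Fin.Subset using (Subset; _∈_; _∉_; _⊆_; _⊂_; _-_; _─_; ⁅_⁆; inside)
open import Data.Fin.Subset.Properties
  using (_∈?_; _⊂?_; ⊆-trans; p─q⊆p; x∈p∧x≢y⇒x∈p-y; x∈p⇒p-x⊂p; x∈⁅x⁆; anySubset?)
open import Data.Fin.Subset.Induction using (⊂-wellFounded)
open import Data.Bool as Bool using (Bool; true; _∨_)
open import Data.Vec using (tabulate; _∷_; here; there)
open import Data.Vec.Properties using (lookup∘tabulate; []=⇒lookup; lookup⇒[]=; ≡-dec)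
open import Data.List using (List; []; _∷_; _∷ʳ_; length; lookup)
open import Data.List.Reverse using (Reverse; []; _∶_∶ʳ_; reverseView)
open import Data.List.Relation.Unary.All using (All; []; _∷_)
open import Data.List.Relation.Unary.All.Properties using (++⁻ˡ; ∷ʳ⁺; ∷ʳ⁻)
open import Data.Product using (∃; _×_; _,_; proj₁; proj₂)
open import Data.Sum using (_⊎_; inj₁; inj₂; swap)
open import Data.Unit using (⊤; tt)
open import Data.Empty using (⊥; ⊥-elim)
open import Relation.Nullary using (¬_; Dec; yes; no; does)
open import Relation.Nullary.Decidable using (_×-dec_; _⊎-dec_; _→-dec_; ¬?; decidable-stable)
open import Relation.Binary.PropositionalEquality using (_≡_; _≢_; refl; sym; trans; cong; subst)
open import Induction.WellFounded using (Acc; acc)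
open import Function using (_∘_)
open import Function.Bundles using (_⇔_; mk⇔; Equivalence)
open Equivalence using (to; from)
import Function.Properties.Equivalence as ⇔

does-true : ∀ {A : Set} (d : Dec A) → does d ≡ true ⇔ A
does-true (yes a) = mk⇔ (λ _ → a) (λ _ → refl)
does-true (no ¬a) = mk⇔ (λ ()) (⊥-elim ∘ ¬a)

does-∨ : ∀ {A : Set} (d : Dec A) b → does d ∨ b ≡ true ⇔ (A ⊎ b ≡ true)
does-∨ (yes a) b = mk⇔ (λ _ → inj₁ a) (λ _ → refl)
does-∨ (no ¬a) b = mk⇔ inj₂ λ { (inj₁ a) → ⊥-elim (¬a a) ; (inj₂ e) → e }

module _ {n : ℕ} where

  ∈-tabulate : ∀ (f : Fin n → Bool) {v} → v ∈ tabulate f ⇔ f v ≡ true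
  ∈-tabulate f {v} = mk⇔
    (λ v∈ → trans (sym (lookup∘tabulate f v)) ([]=⇒lookup v∈))
    (λ fv → lookup⇒[]= v (tabulate f) (trans (lookup∘tabulate f v) fv))

  select : ∀ {P : Fin n → Set} → (∀ v → Dec (P v)) → Subset n
  select P? = tabulate (λ v → does (P? v))

  ∈-select : ∀ {P : Fin n → Set} (P? : ∀ v → Dec (P v)) {v} → v ∈ select P? ⇔ P v
  ∈-select P? {v} = ⇔.trans (∈-tabulate (λ v → does (P? v))) (does-true (P? v))

  x∉p-x : ∀ (p : Subset n) x → x ∉ p - x
  x∉p-x p x x∈ = go p ⁅ x ⁆ x∈ (x∈⁅x⁆ x)
    where
    go : ∀ {m} (p q : Subset m) {y} → y ∈ p ─ q → y ∉ q
    go (_ ∷ p) (inside ∷ q) () here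
    go (_ ∷ p) (_ ∷ q) (there h) (there h') = go p q h h'

  ∈-remove⁻ : ∀ {p : Subset n} {x y} → y ∈ p - x → y ∈ p × y ≢ x
  ∈-remove⁻ {p} {x} y∈ = p─q⊆p p ⁅ x ⁆ y∈ , λ { refl → x∉p-x p x y∈ }

module _ {n : ℕ} (G : Graph n) where

  infix 4 _∼_

  _∼_ : Fin n → Fin n → Set
  a ∼ b = adj G a b ≡ true

  N : Fin n → Subset n
  N = N[_] G

  Near : Fin n → Fin n → Set
  Near a b = a ≡ b ⊎ a ∼ b

  Far : Fin n → Fin n → Set
  Far a b = ¬ Near a b

  ∼-sym : ∀ {a b} → a ∼ b → b ∼ a
  ∼-sym {a} {b} a∼b = trans (Graph.sym G b a) a∼b

  ∼⇒≢ : ∀ {a b} → a ∼ b → a ≢ b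
  ∼⇒≢ {a} a∼a refl with () ← trans (sym a∼a) (irrefl G a)

  Near-sym : ∀ {a b} → Near a b → Near b a
  Near-sym (inj₁ refl) = inj₁ refl
  Near-sym (inj₂ a∼b)  = inj₂ (∼-sym a∼b)

  Far-sym : ∀ {a b} → Far a b → Far b a
  Far-sym far = far ∘ Near-sym

  near? : ∀ a b → Dec (Near a b)
  near? a b = (a ≟ b) ⊎-dec (adj G a b Bool.≟ true)

  adjacent : ∀ {a b} → Near a b → a ≢ b → a ∼ b
  adjacent (inj₁ a≡b) a≢b = ⊥-elim (a≢b a≡b)
  adjacent (inj₂ a∼b) _   = a∼b

  separated : ∀ {a b c} → Near c a → Far c b → a ≢ b
  separated c~a far refl = far c~a

  ∈N⇔Near : ∀ {a b} → b ∈ N a ⇔ Near a b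
  ∈N⇔Near {a} {b} = ⇔.trans (∈-tabulate (λ y → does (a ≟ y) ∨ adj G a y)) (does-∨ (a ≟ b) (adj G a b))

  near-⊆ : ∀ {w t e} → N w ⊆ N t → Near e w → Near e t
  near-⊆ w⊆t e~w = Near-sym (to ∈N⇔Near (w⊆t (from ∈N⇔Near (Near-sym e~w))))

  IndPath : List (Fin n) → Set
  IndPath []           = ⊤
  IndPath (a ∷ [])     = ⊤
  IndPath (a ∷ b ∷ cs) = a ∼ b × All (Far a) cs × IndPath (b ∷ cs)

  indPath-tail : ∀ {a} cs → IndPath (a ∷ cs) → IndPath cs
  indPath-tail []      _ = tt
  indPath-tail (b ∷ cs) (_ , _ , path) = path

  indPath-init : ∀ {x} cs → IndPath (cs ∷ʳ x) → IndPath cs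
  indPath-init []           _ = tt
  indPath-init (a ∷ [])     _ = tt
  indPath-init (a ∷ b ∷ cs) (a∼b , far , path) = a∼b , ++⁻ˡ cs far , indPath-init (b ∷ cs) path

  all-lookup : ∀ {P : Fin n → Set} {cs} → All P cs → ∀ k → P (lookup cs k)
  all-lookup (p ∷ _)  zero    = p
  all-lookup (_ ∷ ps) (suc k) = all-lookup ps k

  PathAdj-sym : ∀ {k} {i j : Fin k} → PathAdj G i j ⇔ PathAdj G j i
  PathAdj-sym = mk⇔ swap swap

  PathAdj-suc : ∀ {k} {i j : Fin k} → PathAdj G (suc i) (suc j) ⇔ PathAdj G i j
  PathAdj-suc = mk⇔
    (λ { (inj₁ e) → inj₁ (suc-injective e) ; (inj₂ e) → inj₂ (suc-injective e) })
    (λ { (inj₁ e) → inj₁ (cong suc e) ; (inj₂ e) → inj₂ (cong suc e) })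

  path-adj₀ : ∀ {a} cs → IndPath (a ∷ cs) → ∀ j → (a ∼ lookup cs j) ⇔ PathAdj G zero (suc j)
  path-adj₀ (b ∷ cs) (a∼b , _ , _) zero = mk⇔ (λ _ → inj₁ refl) (λ _ → a∼b)
  path-adj₀ (b ∷ cs) (_ , far , _) (suc k) =
    mk⇔ (λ a∼c → ⊥-elim (all-lookup far k (inj₂ a∼c))) λ { (inj₁ ()) ; (inj₂ ()) }

  path-distinct₀ : ∀ {a} cs → IndPath (a ∷ cs) → ∀ j → a ≢ lookup cs j
  path-distinct₀ (b ∷ cs) (a∼b , _ , _)  zero    = ∼⇒≢ a∼b
  path-distinct₀ (b ∷ cs) (_ , far , _) (suc k) = all-lookup far k ∘ inj₁

  path-adj : ∀ cs → IndPath cs → ∀ i j → (lookup cs i ∼ lookup cs j) ⇔ PathAdj G i j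
  path-adj (a ∷ cs) _ zero zero =
    mk⇔ (λ a∼a → ⊥-elim (∼⇒≢ a∼a refl)) λ { (inj₁ ()) ; (inj₂ ()) }
  path-adj (a ∷ cs) path zero (suc j) = path-adj₀ cs path j
  path-adj (a ∷ cs) path (suc i) zero =
    ⇔.trans (mk⇔ ∼-sym ∼-sym) (⇔.trans (path-adj₀ cs path i) PathAdj-sym)
  path-adj (a ∷ cs) path (suc i) (suc j) =
    ⇔.trans (path-adj cs (indPath-tail cs path) i j) (⇔.sym PathAdj-suc)

  path-injective : ∀ cs → IndPath cs → ∀ i j → lookup cs i ≡ lookup cs j → i ≡ j
  path-injective (a ∷ cs) _    zero    zero    _ = refl
  path-injective (a ∷ cs) path zero    (suc j) e = ⊥-elim (path-distinct₀ cs path j e)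
  path-injective (a ∷ cs) path (suc i) zero    e = ⊥-elim (path-distinct₀ cs path i (sym e))
  path-injective (a ∷ cs) path (suc i) (suc j) e = cong suc (path-injective cs (indPath-tail cs path) i j e)

  indPath⇒HasInducedPath : ∀ cs → IndPath cs → HasInducedPath G (length cs)
  indPath⇒HasInducedPath cs path =
    lookup cs , (λ {i} {j} → path-injective cs path i j) , path-adj cs path

  Closes : Fin n → List (Fin n) → Set
  Closes v []           = ⊥
  Closes v (c ∷ [])     = v ∼ c
  Closes v (c ∷ d ∷ cs) = Far v c × Closes v (d ∷ cs)

  closes-snoc : ∀ {v x} cs → All (Far v) cs → v ∼ x → Closes v (cs ∷ʳ x)
  closes-snoc []           []          v∼x = v∼x
  closes-snoc (c ∷ [])     (far ∷ [])  v∼x = far , v∼x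
  closes-snoc (c ∷ d ∷ cs) (far ∷ fs)  v∼x = far , closes-snoc (d ∷ cs) fs v∼x

  closes-adj : ∀ {v} cs → Closes v cs → ∀ k → (v ∼ lookup cs k) ⇔ suc (toℕ k) ≡ length cs
  closes-adj (c ∷ [])     v∼c        zero    = mk⇔ (λ _ → refl) (λ _ → v∼c)
  closes-adj (c ∷ d ∷ cs) (far , _)  zero    = mk⇔ (λ v∼c → ⊥-elim (far (inj₂ v∼c))) λ ()
  closes-adj (c ∷ d ∷ cs) (_ , rest) (suc k) =
    ⇔.trans (closes-adj (d ∷ cs) rest k) (mk⇔ (cong suc) suc-injective)

  closes-distinct : ∀ {v} cs → Closes v cs → ∀ k → v ≢ lookup cs k
  closes-distinct (c ∷ [])     v∼c        zero    = ∼⇒≢ v∼c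
  closes-distinct (c ∷ d ∷ cs) (far , _)  zero    = far ∘ inj₁
  closes-distinct (c ∷ d ∷ cs) (_ , rest) (suc k) = closes-distinct (d ∷ cs) rest k

  CycAdj-sym : ∀ {k} {i j : Fin k} → CycAdj G i j ⇔ CycAdj G j i
  CycAdj-sym = mk⇔ flip flip
    where
    flip : ∀ {k} {i j : Fin k} → CycAdj G i j → CycAdj G j i
    flip (inj₁ p)        = inj₁ (swap p)
    flip (inj₂ (inj₁ w)) = inj₂ (inj₂ w)
    flip (inj₂ (inj₂ w)) = inj₂ (inj₁ w)

  module _ {v p : Fin n} (cs : List (Fin n)) (path : IndPath (p ∷ cs)) (v∼p : v ∼ p) (closes : Closes v cs) where

    private
      cycle : List (Fin n)
      cycle = v ∷ p ∷ cs

    cycle-adj₀ : ∀ j → (v ∼ lookup (p ∷ cs) j) ⇔ CycAdj G {length cycle} zero (suc j)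
    cycle-adj₀ zero    = mk⇔ (λ _ → inj₁ (inj₁ refl)) (λ _ → v∼p)
    cycle-adj₀ (suc k) = mk⇔
      (λ v∼c → inj₂ (inj₁ (refl , cong (ℕ.suc ∘ ℕ.suc) (to (closes-adj cs closes k) v∼c))))
      λ { (inj₁ (inj₁ ()))
        ; (inj₁ (inj₂ ()))
        ; (inj₂ (inj₁ (_ , e))) → from (closes-adj cs closes k) (suc-injective (suc-injective e))
        ; (inj₂ (inj₂ (() , _))) }

    cycle-adj : ∀ i j → (lookup cycle i ∼ lookup cycle j) ⇔ CycAdj G i j
    cycle-adj zero zero = mk⇔ (λ v∼v → ⊥-elim (∼⇒≢ v∼v refl))
      λ { (inj₁ (inj₁ ())) ; (inj₁ (inj₂ ())) ; (inj₂ (inj₁ (_ , ()))) ; (inj₂ (inj₂ (_ , ()))) }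
    cycle-adj zero (suc j) = cycle-adj₀ j
    cycle-adj (suc i) zero = ⇔.trans (mk⇔ ∼-sym ∼-sym) (⇔.trans (cycle-adj₀ i) CycAdj-sym)
    cycle-adj (suc i) (suc j) = ⇔.trans (path-adj (p ∷ cs) path i j) (mk⇔
      (inj₁ ∘ from PathAdj-suc)
      λ { (inj₁ q) → to PathAdj-suc q ; (inj₂ (inj₁ (() , _))) ; (inj₂ (inj₂ (() , _))) })

    cycle-distinct₀ : ∀ j → v ≢ lookup (p ∷ cs) j
    cycle-distinct₀ zero    = ∼⇒≢ v∼p
    cycle-distinct₀ (suc k) = closes-distinct cs closes k

    cycle-injective : ∀ i j → lookup cycle i ≡ lookup cycle j → i ≡ j
    cycle-injective zero    zero    _ = refl
    cycle-injective zero    (suc j) e = ⊥-elim (cycle-distinct₀ j e)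
    cycle-injective (suc i) zero    e = ⊥-elim (cycle-distinct₀ i (sym e))
    cycle-injective (suc i) (suc j) e = cong suc (path-injective (p ∷ cs) path i j e)

    closedPath⇒HasInducedCycle : HasInducedCycle G (length cycle)
    closedPath⇒HasInducedCycle = lookup cycle , (λ {i} {j} → cycle-injective i j) , cycle-adj

  module ChordalExtension (chordal : Chordal G) where

    private
      atLeastFour : ∀ {a b c} (cs : List (Fin n)) x → 4 ℕ.≤ length (a ∷ b ∷ c ∷ cs ∷ʳ x)
      atLeastFour []      _ = s≤s (s≤s (s≤s (s≤s z≤n)))
      atLeastFour (_ ∷ _) _ = s≤s (s≤s (s≤s (s≤s z≤n)))

    -- Induction from the end of the path:
    -- were v near the last vertex ℓ, then v ≠ ℓ (ℓ is far from p) and v, p, c,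
    -- …, ℓ would be an induced cycle of length at least four.
    farFromRest : ∀ {v p c cs} → Reverse cs → IndPath (p ∷ c ∷ cs) → v ∼ p → Far v c → All (Far v) cs
    farFromRest [] _ _ _ = []
    farFromRest {v} {p} {c} (init ∶ rev ∶ʳ ℓ) path@(_ , p-far , _) v∼p v-far-c = ∷ʳ⁺ far-init far-ℓ
      where
      far-init : All (Far v) init
      far-init = farFromRest rev (indPath-init (p ∷ c ∷ init) path) v∼p v-far-c

      far-ℓ : Far v ℓ
      far-ℓ (inj₁ refl) = proj₂ (∷ʳ⁻ p-far) (inj₂ (∼-sym v∼p))
      far-ℓ (inj₂ v∼ℓ)  = chordal _ (atLeastFour {v} {p} {c} init ℓ)
        (closedPath⇒HasInducedCycle (c ∷ init ∷ʳ ℓ) path v∼p (closes-snoc (c ∷ init) (v-far-c ∷ far-init) v∼ℓ))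

    extend : ∀ {v p c cs} → IndPath (p ∷ c ∷ cs) → v ∼ p → Far v c → IndPath (v ∷ p ∷ c ∷ cs)
    extend {cs = cs} path v∼p v-far-c = v∼p , v-far-c ∷ farFromRest (reverseView cs) path v∼p v-far-c , path

  Private : Subset n → Fin n → Fin n → Set
  Private D a u = Near a u × (∀ e → e ∈ D → e ≢ a → Far e u)

  SharedWith : Subset n → Fin n → Fin n → Set
  SharedWith D a t = ∃ λ e → e ∈ D × e ≢ a × Near e t

  DoublyDominated : Subset n → Fin n → Set
  DoublyDominated D z = SharedWith D z z

  sharedWith? : ∀ D a t → Dec (SharedWith D a t)
  sharedWith? D a t = any? (λ e → (e ∈? D) ×-dec ¬? (e ≟ a) ×-dec near? e t)

  privateOrShared : ∀ D {a t} → Near a t → Private D a t ⊎ SharedWith D a t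
  privateOrShared D {a} {t} a~t with sharedWith? D a t
  ... | yes shared = inj₂ shared
  ... | no none    = inj₁ (a~t , λ e e∈D e≢a e~t → none (e , e∈D , e≢a , e~t))

  private⇒member : ∀ {S D' v u} → D' ⊆ S → Dominating G D' → Private S v u → v ∈ D'
  private⇒member {v = v} {u} D'⊆S dom (_ , alone) with dom u
  ... | e , e∈D' , u∈Ne with e ≟ v
  ...   | yes refl = e∈D'
  ...   | no e≢v   = ⊥-elim (alone e (D'⊆S e∈D') e≢v (to ∈N⇔Near u∈Ne))

  -- Every vertex of a minimal dominating set has a private neighbour: a vertex
  -- not dominated by D - a is one.
  privateNeighbour : ∀ {D a} → MinimalDominating G D → a ∈ D → ∃ (Private D a)
  privateNeighbour {D} {a} (dom , minimal) a∈D
    with ¬∀⟶∃¬ n _ (λ t → any? (λ d → (d ∈? D - a) ×-dec (t ∈? N d))) (minimal (D - a) (x∈p⇒p-x⊂p a∈D))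
  ... | t , undominated = t , near-a , alone
    where
    alone : ∀ e → e ∈ D → e ≢ a → Far e t
    alone e e∈D e≢a e~t = undominated (e , x∈p∧x≢y⇒x∈p-y e∈D e≢a , from ∈N⇔Near e~t)

    near-a : Near a t
    near-a with dom t
    ... | d , d∈D , t∈Nd with d ≟ a
    ...   | yes refl = to ∈N⇔Near t∈Nd
    ...   | no d≢a   = ⊥-elim (alone d d∈D d≢a (to ∈N⇔Near t∈Nd))

  dominating? : ∀ D → Dec (Dominating G D)
  dominating? D = all? (λ v → any? (λ d → (d ∈? D) ×-dec (v ∈? N d)))

  minimalDominatingBelow : ∀ D → Dominating G D → ∃ λ D' → D' ⊆ D × MinimalDominating G D'
  minimalDominatingBelow D = go D (⊂-wellFounded D)
    where
    go : ∀ D → Acc _⊂_ D → Dominating G D → ∃ λ D' → D' ⊆ D × MinimalDominating G D'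
    go D (acc smaller) dom with anySubset? (λ D' → (D' ⊂? D) ×-dec dominating? D')
    ... | yes (D' , D'⊂D , dom') =
          let (D'' , D''⊆D' , minimal) = go D' (smaller D'⊂D) dom'
          in D'' , ⊆-trans D''⊆D' (proj₁ D'⊂D) , minimal
    ... | no none = D , (λ v∈D → v∈D) , dom , λ D' D'⊂D dom' → none (D' , D'⊂D , dom')

  minimalNeighbourhoodBelow : ∀ t → ∃ λ w → N w ⊆ N t × (∀ y → ¬ N y ⊂ N w)
  minimalNeighbourhoodBelow t = go t (⊂-wellFounded (N t))
    where
    go : ∀ t → Acc _⊂_ (N t) → ∃ λ w → N w ⊆ N t × (∀ y → ¬ N y ⊂ N w)
    go t (acc smaller) with any? (λ y → N y ⊂? N t)
    ... | yes (y , y⊂t) =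
          let (w , w⊆y , minimal) = go y (smaller y⊂t)
          in w , ⊆-trans w⊆y (proj₁ y⊂t) , minimal
    ... | no none = t , (λ v∈Nt → v∈Nt) , λ y y⊂t → none (y , y⊂t)

  leastTwin : ∀ w → ∃ λ w' → N w' ≡ N w × (∀ y → toℕ y ℕ.< toℕ w' → N y ≢ N w')
  leastTwin w = go w (<-wellFounded w)
    where
    go : ∀ w → Acc _<_ w → ∃ λ w' → N w' ≡ N w × (∀ y → toℕ y ℕ.< toℕ w' → N y ≢ N w')
    go w (acc smaller) with any? (λ y → (y <? w) ×-dec ≡-dec Bool._≟_ (N y) (N w))
    ... | yes (y , y<w , same) =
          let (w' , same' , least) = go y (smaller y<w)
          in w' , trans same' same , least
    ... | no none = w , refl , λ y y<w same → none (y , y<w , same)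

  irredundantBelow : ∀ t → ∃ λ w → Irredundant G w × N w ⊆ N t
  irredundantBelow t with minimalNeighbourhoodBelow t
  ... | w , w⊆t , minimal with leastTwin w
  ...   | w' , same , least =
          w' , ((λ y y⊂w' → minimal y (subst (N y ⊂_) same y⊂w')) , least) , subst (_⊆ N t) (sym same) w⊆t

  private-⊆ : ∀ {D x t w} → Dominating G D → Private D x t → N w ⊆ N t → Private D x w
  private-⊆ {D} {x} {t} {w} dom (_ , alone) w⊆t = near-x , others
    where
    others : ∀ e → e ∈ D → e ≢ x → Far e w
    others e e∈D e≢x e~w = alone e e∈D e≢x (near-⊆ w⊆t e~w)

    near-x : Near x w
    near-x with dom w
    ... | e , e∈D , w∈Ne with e ≟ x
    ...   | yes refl = to ∈N⇔Near w∈Ne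
    ...   | no e≢x   = ⊥-elim (others e e∈D e≢x (to ∈N⇔Near w∈Ne))

  Exchangeable : Subset n → Fin n → Set
  Exchangeable D x = ∀ {z u w} → z ∈ D → z ≢ x → Redundant G z → DoublyDominated D z →
                     Private D z u → Irredundant G w → Private D x w → Far w u

  irredundant? : ∀ w → Dec (Irredundant G w)
  irredundant? w = all? (λ y → ¬? (N y ⊂? N w))
                 ×-dec all? (λ y → (toℕ y ℕ.<? toℕ w) →-dec ¬? (≡-dec Bool._≟_ (N y) (N w)))

  private? : ∀ D a u → Dec (Private D a u)
  private? D a u = near? a u ×-dec all? (λ e → (e ∈? D) →-dec (¬? (e ≟ a) →-dec ¬? (near? e u)))

  module Exchange {D X : Subset n} {x : Fin n} (md : MinimalDominating G D)
    (trace : ∀ v → (v ∈ X) ⇔ (v ∈ D × Redundant G v)) (x∈X : x ∈ X)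
    (exchangeable : Exchangeable D x) where

    InReplacement : Fin n → Set
    InReplacement v = (v ∈ D × v ≢ x) ⊎ (Irredundant G v × Private D x v)

    inReplacement? : ∀ v → Dec (InReplacement v)
    inReplacement? v = ((v ∈? D) ×-dec ¬? (v ≟ x)) ⊎-dec (irredundant? v ×-dec private? D x v)

    D₁ : Subset n
    D₁ = select inReplacement?

    ∈D₁⇔ : ∀ {v} → v ∈ D₁ ⇔ InReplacement v
    ∈D₁⇔ = ∈-select inReplacement?

    -- A vertex dominated only by x is now dominated by an irredundant vertex below it.
    D₁-dominating : Dominating G D₁
    D₁-dominating t with proj₁ md t
    ... | d , d∈D , t∈Nd with d ≟ x
    ...   | no d≢x = d , from ∈D₁⇔ (inj₁ (d∈D , d≢x)) , t∈Nd
    ...   | yes refl with privateOrShared D (to ∈N⇔Near t∈Nd)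
    ...     | inj₂ (e , e∈D , e≢x , e~t) = e , from ∈D₁⇔ (inj₁ (e∈D , e≢x)) , from ∈N⇔Near e~t
    ...     | inj₁ t-private with irredundantBelow t
    ...       | w , w-irr , w⊆t =
                w , from ∈D₁⇔ (inj₂ (w-irr , private-⊆ (proj₁ md) t-private w⊆t))
                  , from ∈N⇔Near (near-⊆ w⊆t (inj₁ refl))

    D' : Subset n
    D' = proj₁ (minimalDominatingBelow D₁ D₁-dominating)

    D'⊆D₁ : D' ⊆ D₁
    D'⊆D₁ = proj₁ (proj₂ (minimalDominatingBelow D₁ D₁-dominating))

    D'-minimal : MinimalDominating G D'
    D'-minimal = proj₂ (proj₂ (minimalDominatingBelow D₁ D₁-dominating))

    farFromD₁ : ∀ {z u} → (∀ e → e ∈ D → e ≢ z → Far e u) →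
                (∀ {w} → Irredundant G w → Private D x w → Far w u) →
                ∀ e → e ∈ D₁ → e ≢ z → Far e u
    farFromD₁ old new e e∈D₁ e≢z with to ∈D₁⇔ e∈D₁
    ... | inj₁ (e∈D , _)       = old e e∈D e≢z
    ... | inj₂ (w-irr , w-priv) = new w-irr w-priv

    -- Every z ∈ X - x keeps a private neighbour with respect to D₁: itself if
    -- it is dominated only by itself, otherwise its private neighbour in D.
    privateInD₁ : ∀ {z} → z ∈ D → z ≢ x → Redundant G z → ∃ (Private D₁ z)
    privateInD₁ {z} z∈D z≢x z-red with privateOrShared D {z} {z} (inj₁ refl)
    ... | inj₁ (_ , alone) = z , inj₁ refl , farFromD₁ alone (λ _ w-priv → Far-sym (proj₂ w-priv z z∈D z≢x))
    ... | inj₂ shared =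
          let (u , u-priv) = privateNeighbour md z∈D
          in u , proj₁ u-priv , farFromD₁ (proj₂ u-priv) (exchangeable z∈D z≢x z-red shared u-priv)

    kept : ∀ {v} → v ∈ X - x → v ∈ D' × Redundant G v
    kept {v} v∈ =
      let (v∈X , v≢x)  = ∈-remove⁻ v∈
          (v∈D , v-red) = to (trace v) v∈X
          (u , u-priv)  = privateInD₁ v∈D v≢x v-red
      in private⇒member D'⊆D₁ (proj₁ D'-minimal) u-priv , v-red

    -- The vertices added to D are irredundant, so the redundant part of D' lies in D.
    onlyOld : ∀ {v} → v ∈ D' × Redundant G v → v ∈ X - x
    onlyOld {v} (v∈D' , v-red) with to ∈D₁⇔ (D'⊆D₁ v∈D')
    ... | inj₁ (v∈D , v≢x) = x∈p∧x≢y⇒x∈p-y (from (trace v) (v∈D , v-red)) v≢x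
    ... | inj₂ (v-irr , _) = ⊥-elim (v-red v-irr)

    removable : InDRN G (X - x)
    removable = D' , D'-minimal , λ v → mk⇔ kept onlyOld

  outsideNeighbourhood : ∀ {x w u} → Irredundant G w → Near w u → Far x u → ∃ λ r → Near x r × Far w r
  outsideNeighbourhood {x} {w} {u} w-irr w~u x-far-u with any? (λ r → near? x r ×-dec ¬? (near? w r))
  ... | yes found = found
  ... | no none   = ⊥-elim (proj₁ w-irr x (Nx⊆Nw , u , from ∈N⇔Near w~u , x-far-u ∘ to ∈N⇔Near))
    where
    Nx⊆Nw : N x ⊆ N w
    Nx⊆Nw {r} r∈Nx = from ∈N⇔Near (decidable-stable (near? w r) (λ w-far-r → none (r , to ∈N⇔Near r∈Nx , w-far-r)))

  module PathFree (chordal : Chordal G) {D : Subset n} (md : MinimalDominating G D) where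
    open ChordalExtension chordal

    spine : ∀ {x z u w} → x ∈ D → z ∈ D → z ≢ x → DoublyDominated D z →
            Private D z u → Private D x w → Near w u →
            ∃ λ d → ∃ λ q → IndPath (x ∷ w ∷ u ∷ z ∷ d ∷ q ∷ [])
    spine {x} {z} {u} {w} x∈D z∈D z≢x (d , d∈D , d≢z , d~z) (z~u , u-alone) (x~w , w-alone) w~u =
      d , q , x-w-u-z-d-q
      where
      q = proj₁ (privateNeighbour md d∈D)
      d~q = proj₁ (proj₂ (privateNeighbour md d∈D))
      q-alone = proj₂ (proj₂ (privateNeighbour md d∈D))

      z-far-q : Far z q
      z-far-q = q-alone z z∈D (d≢z ∘ sym)
      u-far-d : Far u d
      u-far-d = Far-sym (u-alone d d∈D d≢z)
      w-far-z : Far w z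
      w-far-z = Far-sym (w-alone z z∈D z≢x)
      x-far-u : Far x u
      x-far-u = u-alone x x∈D (z≢x ∘ sym)

      x-w-u-z-d-q : IndPath (x ∷ w ∷ u ∷ z ∷ d ∷ q ∷ [])
      x-w-u-z-d-q =
        extend (extend (extend (extend
          (adjacent d~q (separated (Near-sym d~z) z-far-q) , [] , tt)
          (adjacent (Near-sym d~z) (d≢z ∘ sym)) z-far-q)
          (adjacent (Near-sym z~u) (separated w~u w-far-z)) u-far-d)
          (adjacent w~u (separated x~w x-far-u)) w-far-z)
          (adjacent x~w (separated (Near-sym w~u) (Far-sym x-far-u) ∘ sym)) x-far-u

    -- P₇: a vertex r ∈ N[x] - N[w] prolongs the spine at x.
    exchangeable-P7 : PFree G 7 → ∀ {x} → x ∈ D → Exchangeable D x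
    exchangeable-P7 p7 x∈D z∈D z≢x _ shared u-priv w-irr w-priv w~u
      with spine x∈D z∈D z≢x shared u-priv w-priv w~u
         | outsideNeighbourhood w-irr w~u (proj₂ u-priv _ x∈D (z≢x ∘ sym))
    ... | _ , _ , path | r , x~r , w-far-r =
          p7 (indPath⇒HasInducedPath _ (extend path r∼x (Far-sym w-far-r)))
      where
      r∼x = adjacent (Near-sym x~r) (separated (Near-sym (proj₁ w-priv)) w-far-r ∘ sym)

    -- P₈: a second dominator e of x and its private neighbour s prolong the spine.
    exchangeable-P8 : PFree G 8 → ∀ {x} → x ∈ D → DoublyDominated D x → Exchangeable D x
    exchangeable-P8 p8 {x} x∈D (e , e∈D , e≢x , e~x) z∈D z≢x _ shared u-priv _ w-priv w~u
      with spine x∈D z∈D z≢x shared u-priv w-priv w~u | privateNeighbour md e∈D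
    ... | _ , _ , path | s , e~s , s-alone =
          p8 (indPath⇒HasInducedPath _ (extend (extend path e∼x e-far-w) s∼e (Far-sym x-far-s)))
      where
      e∼x = adjacent e~x e≢x
      e-far-w = proj₂ w-priv e e∈D e≢x
      x-far-s = s-alone x x∈D (e≢x ∘ sym)
      s∼e = ∼-sym (adjacent e~s (separated (Near-sym e~x) x-far-s))

  independence : Chordal G → PFree G 7 → IndependenceSystem (InDRN G)
  independence chordal p7 X (D , md , trace) _ x x∈X =
    Exchange.removable md trace x∈X (PathFree.exchangeable-P7 chordal md p7 (proj₁ (to (trace x) x∈X)))

  -- Remove a doubly dominated vertex of X if there is one; otherwise the
  -- exchange condition holds vacuously for every x ∈ X.
  accessibility : Chordal G → PFree G 8 → AccessibleSetSystem (InDRN G)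
  accessibility chordal p8 X (D , md , trace) (x₀ , x₀∈X)
    with any? (λ x → (x ∈? X) ×-dec sharedWith? D x x)
  ... | yes (x , x∈X , shared) =
        x , x∈X , Exchange.removable md trace x∈X
                    (PathFree.exchangeable-P8 chordal md p8 (proj₁ (to (trace x) x∈X)) shared)
  ... | no none =
        x₀ , x₀∈X , Exchange.removable md trace x₀∈X
                      (λ {z} z∈D _ z-red shared → ⊥-elim (none (z , from (trace z) (z∈D , z-red) , shared)))

proposition5 : ∀ {n} (G : Graph n) → Chordal G →
    (PFree G 7 → IndependenceSystem (InDRN G))
    × (PFree G 8 → AccessibleSetSystem (InDRN G))
proposition5 G chordal = independence G chordal , accessibility G chordal
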